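{- Let $q$ be an odd prime power and let $\mathcal{J}_{\mathbb{F}_q}$ be the directed graph defined below. For a positive integer $n$, let $M_n$ denote the number of directed (oriented) cycles of length $n$ in $\mathcal{J}_{\mathbb{F}_q}$. Then for every positive integer $n$, $(q-1)$ divides $nM_n$.
   Context: $\mathbb{F}_q$ is the finite field with $q$ elements, $q$ odd. $\phi_q\colon \mathbb{F}_q^\times\to\{\pm1\}$ is the quadratic character: $\phi_q(a)=1$ if $a$ is a square in $\mathbb{F}_q^\times$ and $-1$ otherwise. The directed graph $\mathcal{J}_{\mathbb{F}_q}=(V,E)$ has vertex set $V=\{(a,b)\in(\mathbb{F}_q^\times)^2 : \phi_q(ab)=1,\ a\neq \pm b\}$, and for $(a,b),(c,d)\in V$ there is an edge $(a,b)\to(c,d)$ if and only if $c=\frac{a+b}{2}$ and $d^2=ab$. -}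

module Defs where

open import Data.Nat using (ℕ; zero; suc; _<_; _<?_)
open import Data.Fin using (Fin; zero; suc; toℕ; fromℕ; inject₁)
open import Data.Fin.Properties using (_≟_; all?; any?)
open import Data.Product using (Σ; ∃; _×_; _,_; proj₁; proj₂)
open import Data.Product.Properties using (≡-dec)
open import Data.Product.Relation.Binary.Pointwise.NonDependent using ()
open import Data.Sum using (_⊎_)
open import Data.List using (List; []; _∷_; length; filter; concatMap; map)
open import Data.Vec using (Vec; []; _∷_; lookup)
open import Relation.Binary.PropositionalEquality using (_≡_; _≢_)
open import Relation.Nullary using (Dec; ¬_; ¬?)
open import Relation.Nullary.Decidable using (_×-dec_; _⊎-dec_; _→-dec_)
open import Algebra.Structures using (IsCommutativeRing)

-- A finite field with q elements, carrier Fin q, equality propositional.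
-- inv is a total inverse function, required to be a two-sided inverse
-- on nonzero elements (its value at 0 is irrelevant).
record FiniteField (q : ℕ) : Set where
  infixl 6 _+_
  infixl 7 _*_
  field
    _+_ _*_ : Fin q → Fin q → Fin q
    -_      : Fin q → Fin q
    0# 1#   : Fin q
    inv     : Fin q → Fin q
    isCommutativeRing : IsCommutativeRing _≡_ _+_ _*_ -_ 0# 1#
    0≢1     : 0# ≢ 1#
    inv-r   : ∀ x → x ≢ 0# → x * inv x ≡ 1#

module JGraph {q : ℕ} (F : FiniteField q) where
  open FiniteField F

  IsSquare : Fin q → Set
  IsSquare x = ∃ λ y → y * y ≡ x

  φ≡1 : Fin q → Set
  φ≡1 a = (a ≢ 0#) × IsSquare a

  Pt : Set
  Pt = Fin q × Fin q

  IsVertex : Pt → Set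
  IsVertex (a , b) = (a ≢ 0#) × (b ≢ 0#) × φ≡1 (a * b) × (a ≢ b) × (a ≢ - b)

  Edge : Pt → Pt → Set
  Edge (a , b) (c , d) = (c ≡ (a + b) * inv (1# + 1#)) × (d * d ≡ a * b)

  LexLess : Pt → Pt → Set
  LexLess (a , b) (c , d) = (toℕ a < toℕ c) ⊎ ((a ≡ c) × (toℕ b < toℕ d))

  -- A directed cycle of length (suc m), written as a sequence
  -- v₀ → v₁ → … → v_m → v₀ of pairwise distinct vertices, normalised
  -- so that v₀ is the lexicographically least vertex on the cycle
  -- (a canonical representative of the cycle modulo rotation).
  IsCycleRep : (m : ℕ) → Vec Pt (suc m) → Set
  IsCycleRep m v =
      (∀ i → IsVertex (lookup v i))
    × (∀ i j → i ≢ j → lookup v i ≢ lookup v j)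
    × (∀ (i : Fin m) → Edge (lookup v (inject₁ i)) (lookup v (suc i)))
    × Edge (lookup v (fromℕ m)) (lookup v zero)
    × (∀ i → i ≢ zero → LexLess (lookup v zero) (lookup v i))

  _≟P_ : (x y : Pt) → Dec (x ≡ y)
  _≟P_ = ≡-dec _≟_ _≟_

  isSquare? : ∀ x → Dec (IsSquare x)
  isSquare? x = any? (λ y → (y * y) ≟ x)

  isVertex? : ∀ p → Dec (IsVertex p)
  isVertex? (a , b) =
    ¬? (a ≟ 0#) ×-dec ¬? (b ≟ 0#) ×-dec (¬? ((a * b) ≟ 0#) ×-dec isSquare? (a * b))
      ×-dec ¬? (a ≟ b) ×-dec ¬? (a ≟ - b)

  edge? : ∀ p r → Dec (Edge p r)
  edge? (a , b) (c , d) = (c ≟ ((a + b) * inv (1# + 1#))) ×-dec ((d * d) ≟ (a * b))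

  lexLess? : ∀ p r → Dec (LexLess p r)
  lexLess? (a , b) (c , d) = (toℕ a <? toℕ c) ⊎-dec ((a ≟ c) ×-dec (toℕ b <? toℕ d))

  isCycleRep? : ∀ m v → Dec (IsCycleRep m v)
  isCycleRep? m v =
    all? (λ i → isVertex? (lookup v i))
    ×-dec all? (λ i → all? (λ j → ¬? (i ≟ j) →-dec ¬? (lookup v i ≟P lookup v j)))
    ×-dec all? (λ i → edge? (lookup v (inject₁ i)) (lookup v (suc i)))
    ×-dec edge? (lookup v (fromℕ m)) (lookup v zero)
    ×-dec all? (λ i → ¬? (i ≟ zero) →-dec lexLess? (lookup v zero) (lookup v i))

  allFinL : (k : ℕ) → List (Fin k)
  allFinL zero = []
  allFinL (suc k) = zero ∷ map suc (allFinL k)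

  allPts : List Pt
  allPts = concatMap (λ a → map (λ b → (a , b)) (allFinL q)) (allFinL q)

  allVecs : (n : ℕ) → List (Vec Pt n)
  allVecs zero = [] ∷ []
  allVecs (suc n) = concatMap (λ p → map (p ∷_) (allVecs n)) allPts

  cycleCount : ℕ → ℕ
  cycleCount zero = 0
  cycleCount (suc m) = length (filter (isCycleRep? m) (allVecs (suc m)))

module Submission where

-- Count rooted cycles, i.e. directed cycles with a distinguished starting vertex, in two ways.
-- A cycle of length n has n rotations, exactly one of which starts at its lexicographically
-- least vertex, so there are n M_n rooted cycles. On the other hand, for l ≠ 0 the homothety
-- (a , b) ↦ (l a , l b) is an automorphism of the graph, so the number of rooted cycles starting
-- at (a , b) with a ≠ 0 only depends on (1 , b / a), and none start at (0 , b); hence there are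
-- (q − 1) K of them, K being the number that start at some (1 , b).

open import Defs
open import Algebra.Bundles using (CommutativeRing)
import Algebra.Properties.CommutativeSemigroup as CommutativeSemigroupProperties
import Algebra.Properties.Ring as RingProperties
open import Data.Empty using (⊥-elim)
open import Data.Fin as Fin using (Fin; zero; suc; toℕ; fromℕ; inject₁)
open import Data.Fin.Properties as Fin
  using (suc-injective; toℕ-injective; toℕ-inject₁; toℕ-fromℕ; toℕ<n; all?)
open import Data.List using (List; []; _∷_; _++_; map; concatMap; length; filter)
open import Data.List.Properties using (length-map)
open import Data.Nat as ℕ using (ℕ; zero; suc; _+_; _*_; _∸_; _%_; _≤_; _<_; s≤s)
import Data.Nat.Properties as ℕ
open import Data.Nat.Divisibility using (_∣_; divides)
open import Data.Nat.GeneralisedArithmetic using (fold)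
open import Data.Product using (∃; ∃₂; _×_; _,_; proj₁; proj₂)
open import Data.Product.Relation.Binary.Lex.Strict using (×-isStrictTotalOrder)
open import Data.Product.Relation.Binary.Pointwise.NonDependent using (Pointwise; ≡×≡⇒≡)
open import Data.Vec as Vec using (Vec; []; _∷_; lookup; tabulate)
import Data.Vec.Properties as Vec
open import Function using (_∘_)
open import Level using (0ℓ)
open import Relation.Binary.Core using (Rel)
open import Relation.Binary.Definitions using (DecidableEquality; tri<; tri≈; tri>)
open import Relation.Binary.Structures using (IsStrictTotalOrder)
open import Relation.Binary.PropositionalEquality
open import Relation.Nullary using (Dec; yes; no; ¬_; ¬?)
open import Relation.Nullary.Decidable using (_×-dec_; _→-dec_; map′)
open import Relation.Unary using (Decidable)

private
  variable
    A B C : Set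

𝟙 : {P : Set} → Dec P → ℕ
𝟙 (yes _) = 1
𝟙 (no _)  = 0

𝟙-cong : {P Q : Set} (p? : Dec P) (q? : Dec Q) → (P → Q) → (Q → P) → 𝟙 p? ≡ 𝟙 q?
𝟙-cong (yes _) (yes _) _   _   = refl
𝟙-cong (yes p) (no ¬q) p→q _   = ⊥-elim (¬q (p→q p))
𝟙-cong (no ¬p) (yes q) _   q→p = ⊥-elim (¬p (q→p q))
𝟙-cong (no _)  (no _)  _   _   = refl

𝟙-no : {P : Set} (p? : Dec P) → ¬ P → 𝟙 p? ≡ 0
𝟙-no (yes p) ¬p = ⊥-elim (¬p p)
𝟙-no (no _)  _  = refl

∑ : List A → (A → ℕ) → ℕ
∑ []       f = 0
∑ (x ∷ xs) f = f x + ∑ xs f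

syntax ∑ xs (λ x → t) = ∑[ x ∈ xs ] t

∑-cong : (xs : List A) {f g : A → ℕ} → (∀ x → f x ≡ g x) → ∑ xs f ≡ ∑ xs g
∑-cong []       f≗g = refl
∑-cong (x ∷ xs) f≗g = cong₂ _+_ (f≗g x) (∑-cong xs f≗g)

∑-const : (xs : List A) (k : ℕ) → ∑[ x ∈ xs ] k ≡ length xs * k
∑-const []       k = refl
∑-const (x ∷ xs) k = cong (k +_) (∑-const xs k)

∑-zero : (xs : List A) → ∑[ x ∈ xs ] 0 ≡ 0
∑-zero xs = trans (∑-const xs 0) (ℕ.*-zeroʳ (length xs))

∑-+ : (xs : List A) (f g : A → ℕ) → ∑[ x ∈ xs ] (f x + g x) ≡ ∑ xs f + ∑ xs g
∑-+ []       f g = refl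
∑-+ (x ∷ xs) f g =
  trans (cong (f x + g x +_) (∑-+ xs f g)) (+-interchange (f x) (g x) (∑ xs f) (∑ xs g))
  where open CommutativeSemigroupProperties ℕ.+-commutativeSemigroup
          renaming (interchange to +-interchange)

∑-*ʳ : (xs : List A) (f : A → ℕ) (k : ℕ) → ∑[ x ∈ xs ] (f x * k) ≡ ∑ xs f * k
∑-*ʳ []       f k = refl
∑-*ʳ (x ∷ xs) f k = trans (cong (f x * k +_) (∑-*ʳ xs f k)) (sym (ℕ.*-distribʳ-+ k (f x) (∑ xs f)))

∑-swap : (xs : List A) (ys : List B) (f : A → B → ℕ) →
         ∑[ x ∈ xs ] ∑[ y ∈ ys ] f x y ≡ ∑[ y ∈ ys ] ∑[ x ∈ xs ] f x y
∑-swap []       ys f = sym (∑-zero ys)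
∑-swap (x ∷ xs) ys f =
  trans (cong (∑ ys (f x) +_) (∑-swap xs ys f)) (sym (∑-+ ys (f x) (λ y → ∑[ x ∈ xs ] f x y)))

∑-map : (g : A → B) (xs : List A) (f : B → ℕ) → ∑ (map g xs) f ≡ ∑[ x ∈ xs ] f (g x)
∑-map g []       f = refl
∑-map g (x ∷ xs) f = cong (f (g x) +_) (∑-map g xs f)

∑-++ : (xs ys : List A) (f : A → ℕ) → ∑ (xs ++ ys) f ≡ ∑ xs f + ∑ ys f
∑-++ []       ys f = refl
∑-++ (x ∷ xs) ys f = trans (cong (f x +_) (∑-++ xs ys f)) (sym (ℕ.+-assoc (f x) _ _))

∑-concatMap : (g : A → List B) (xs : List A) (f : B → ℕ) →
              ∑ (concatMap g xs) f ≡ ∑[ x ∈ xs ] ∑ (g x) f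
∑-concatMap g []       f = refl
∑-concatMap g (x ∷ xs) f =
  trans (∑-++ (g x) (concatMap g xs) f) (cong (∑ (g x) f +_) (∑-concatMap g xs f))

∑-pairs : (c : A → B → C) (xs : List A) (ys : List B) (f : C → ℕ) →
          ∑ (concatMap (λ a → map (c a) ys) xs) f ≡ ∑[ a ∈ xs ] ∑[ b ∈ ys ] f (c a b)
∑-pairs c xs ys f = trans (∑-concatMap _ xs f) (∑-cong xs (λ a → ∑-map (c a) ys f))

length-filter≡∑𝟙 : {P : A → Set} (P? : Decidable P) (xs : List A) →
                   length (filter P? xs) ≡ ∑[ x ∈ xs ] 𝟙 (P? x)
length-filter≡∑𝟙 P? []       = refl
length-filter≡∑𝟙 P? (x ∷ xs) with P? x
... | yes _ = cong suc (length-filter≡∑𝟙 P? xs)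
... | no  _ = length-filter≡∑𝟙 P? xs

module _ {A : Set} (_≟_ : DecidableEquality A) where

  record Enumerates (xs : List A) : Set where
    field once : ∀ x → ∑[ y ∈ xs ] 𝟙 (x ≟ y) ≡ 1

  open Enumerates public

  module _ {xs : List A} (enum : Enumerates xs) where

    ∑-pick : ∀ x (f : A → ℕ) → ∑[ y ∈ xs ] (𝟙 (x ≟ y) * f y) ≡ f x
    ∑-pick x f = begin
      ∑[ y ∈ xs ] (𝟙 (x ≟ y) * f y) ≡⟨ ∑-cong xs only-x ⟩
      ∑[ y ∈ xs ] (𝟙 (x ≟ y) * f x) ≡⟨ ∑-*ʳ xs (λ y → 𝟙 (x ≟ y)) (f x) ⟩
      (∑[ y ∈ xs ] 𝟙 (x ≟ y)) * f x ≡⟨ cong (_* f x) (enum .once x) ⟩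
      1 * f x                       ≡⟨ ℕ.*-identityˡ (f x) ⟩
      f x                           ∎
      where
      open ≡-Reasoning
      only-x : ∀ y → 𝟙 (x ≟ y) * f y ≡ 𝟙 (x ≟ y) * f x
      only-x y with x ≟ y
      ... | yes refl = refl
      ... | no  _    = refl

    -- Each term f y is rewritten as ∑ₓ [σ x ≡ y] f y; swapping the sums leaves ∑ₓ f (σ x).
    ∑-reindex : (σ τ : A → A) → (∀ x → τ (σ x) ≡ x) → (∀ y → σ (τ y) ≡ y) →
                (f : A → ℕ) → ∑ xs f ≡ ∑[ x ∈ xs ] f (σ x)
    ∑-reindex σ τ τσ στ f = begin
      ∑[ y ∈ xs ] f y                              ≡⟨ ∑-cong xs (λ y → sym (∑-pick (τ y) (λ _ → f y))) ⟩
      ∑[ y ∈ xs ] ∑[ x ∈ xs ] (𝟙 (τ y ≟ x) * f y) ≡⟨ ∑-swap xs xs _ ⟩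
      ∑[ x ∈ xs ] ∑[ y ∈ xs ] (𝟙 (τ y ≟ x) * f y) ≡⟨ ∑-cong xs (λ x → ∑-cong xs (λ y →
                                                       cong (_* f y) (𝟙-cong (τ y ≟ x) (σ x ≟ y)
                                                         (λ { refl → στ y }) (λ { refl → τσ x })))) ⟩
      ∑[ x ∈ xs ] ∑[ y ∈ xs ] (𝟙 (σ x ≟ y) * f y) ≡⟨ ∑-cong xs (λ x → ∑-pick (σ x) f) ⟩
      ∑[ x ∈ xs ] f (σ x)                          ∎
      where open ≡-Reasoning

    ∑-𝟙-≢ : ∀ x → ∑[ y ∈ xs ] 𝟙 (¬? (y ≟ x)) ≡ length xs ∸ 1
    ∑-𝟙-≢ x = begin
      S         ≡⟨ ℕ.m+n∸n≡m S 1 ⟨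
      S + 1 ∸ 1 ≡⟨ cong (_∸ 1) S+1≡length ⟩
      length xs ∸ 1 ∎
      where
      open ≡-Reasoning
      S = ∑[ y ∈ xs ] 𝟙 (¬? (y ≟ x))
      one : ∀ y → 𝟙 (¬? (y ≟ x)) + 𝟙 (x ≟ y) ≡ 1
      one y with y ≟ x | x ≟ y
      ... | yes _   | yes _   = refl
      ... | no  _   | no  _   = refl
      ... | yes y≡x | no x≢y  = ⊥-elim (x≢y (sym y≡x))
      ... | no y≢x  | yes x≡y = ⊥-elim (y≢x (sym x≡y))
      S+1≡length : S + 1 ≡ length xs
      S+1≡length = begin
        S + 1                                      ≡⟨ cong (S +_) (enum .once x) ⟨
        S + ∑[ y ∈ xs ] 𝟙 (x ≟ y)                  ≡⟨ ∑-+ xs _ _ ⟨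
        ∑[ y ∈ xs ] (𝟙 (¬? (y ≟ x)) + 𝟙 (x ≟ y))  ≡⟨ ∑-cong xs one ⟩
        ∑[ y ∈ xs ] 1                              ≡⟨ ∑-const xs 1 ⟩
        length xs * 1                              ≡⟨ ℕ.*-identityʳ _ ⟩
        length xs                                  ∎

enumerates-pairs : (_≟A_ : DecidableEquality A) (_≟B_ : DecidableEquality B) (_≟C_ : DecidableEquality C)
  (c : A → B → C) → (∀ {a b a′ b′} → c a b ≡ c a′ b′ → a ≡ a′ × b ≡ b′) → (∀ z → ∃₂ λ a b → c a b ≡ z) →
  {xs : List A} {ys : List B} → Enumerates _≟A_ xs → Enumerates _≟B_ ys →
  Enumerates _≟C_ (concatMap (λ a → map (c a) ys) xs)
enumerates-pairs _≟A_ _≟B_ _≟C_ c c-injective c-surjective {xs} {ys} enum-xs enum-ys .once z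
  with c-surjective z
... | a , b , refl = begin
  ∑ (concatMap (λ a′ → map (c a′) ys) xs) (λ z′ → 𝟙 (c a b ≟C z′)) ≡⟨ ∑-pairs c xs ys _ ⟩
  ∑[ a′ ∈ xs ] ∑[ b′ ∈ ys ] 𝟙 (c a b ≟C c a′ b′)                   ≡⟨ ∑-cong xs row ⟩
  ∑[ a′ ∈ xs ] 𝟙 (a ≟A a′)                                          ≡⟨ enum-xs .once a ⟩
  1                                                                  ∎
  where
  open ≡-Reasoning
  row : ∀ a′ → ∑[ b′ ∈ ys ] 𝟙 (c a b ≟C c a′ b′) ≡ 𝟙 (a ≟A a′)
  row a′ with a ≟A a′
  ... | yes refl = trans (∑-cong ys (λ b′ → 𝟙-cong (c a b ≟C c a b′) (b ≟B b′)
                           (proj₂ ∘ c-injective) (cong (c a)))) (enum-ys .once b)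
  ... | no a≢a′  = trans (∑-cong ys (λ b′ → 𝟙-no (c a b ≟C c a′ b′) (a≢a′ ∘ proj₁ ∘ c-injective))) (∑-zero ys)

fold-commute : (f g : A → A) → (∀ x → f (g x) ≡ g (f x)) → ∀ x t → fold (f x) g t ≡ f (fold x g t)
fold-commute f g fg≡gf x zero    = refl
fold-commute f g fg≡gf x (suc t) = trans (cong g (fold-commute f g fg≡gf x t)) (sym (fg≡gf _))

fold-inverse : (f g : A → A) → (∀ x → g (f x) ≡ x) → ∀ x t → fold (fold x f t) g t ≡ x
fold-inverse f g gf≡id x zero    = refl
fold-inverse f g gf≡id x (suc t) = begin
  g (fold (f y) g t) ≡⟨ fold-commute g g (λ _ → refl) (f y) t ⟨
  fold (g (f y)) g t ≡⟨ cong (λ z → fold z g t) (gf≡id y) ⟩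
  fold y g t         ≡⟨ fold-inverse f g gf≡id x t ⟩
  x                  ∎
  where
  open ≡-Reasoning
  y = fold x f t

-- The cyclic successor i ↦ i + 1 (mod m + 1); Fin.lift 1 suc fixes zero and sends suc j to suc (suc j).
next : ∀ {m} → Fin (suc m) → Fin (suc m)
next {zero}  zero    = zero
next {suc m} zero    = suc zero
next {suc m} (suc i) = Fin.lift 1 suc (next i)

prev : ∀ {m} → Fin (suc m) → Fin (suc m)
prev {m} zero    = fromℕ m
prev     (suc i) = inject₁ i

next-inject₁ : ∀ {m} (i : Fin m) → next (inject₁ i) ≡ suc i
next-inject₁ {suc m} zero    = refl
next-inject₁ {suc m} (suc i) = cong (Fin.lift 1 suc) (next-inject₁ i)

next-fromℕ : ∀ m → next (fromℕ m) ≡ zero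
next-fromℕ zero    = refl
next-fromℕ (suc m) = cong (Fin.lift 1 suc) (next-fromℕ m)

data LastOrInject₁ {m : ℕ} : Fin (suc m) → Set where
  last     : LastOrInject₁ (fromℕ m)
  inject₁′ : (i : Fin m) → LastOrInject₁ (inject₁ i)

lastOrInject₁ : ∀ {m} (j : Fin (suc m)) → LastOrInject₁ j
lastOrInject₁ {zero}  zero    = last
lastOrInject₁ {suc m} zero    = inject₁′ zero
lastOrInject₁ {suc m} (suc j) with lastOrInject₁ j
... | last       = last
... | inject₁′ i = inject₁′ (suc i)

next-prev : ∀ {m} (j : Fin (suc m)) → next (prev j) ≡ j
next-prev {m} zero = next-fromℕ m
next-prev (suc i)  = next-inject₁ i

prev-next : ∀ {m} (j : Fin (suc m)) → prev (next j) ≡ j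
prev-next {m} j with lastOrInject₁ j
... | last       = cong prev (next-fromℕ m)
... | inject₁′ i = cong prev (next-inject₁ i)

toℕ-next : ∀ {m} (j : Fin (suc m)) → toℕ j < m → toℕ (next j) ≡ suc (toℕ j)
toℕ-next {m} j j<m with lastOrInject₁ j
... | last       = ⊥-elim (ℕ.<-irrefl (toℕ-fromℕ m) j<m)
... | inject₁′ i = trans (cong toℕ (next-inject₁ i)) (cong suc (sym (toℕ-inject₁ i)))

shift : ∀ {m} → ℕ → Fin (suc m) → Fin (suc m)
shift t i = fold i next t

unshift : ∀ {m} → ℕ → Fin (suc m) → Fin (suc m)
unshift t i = fold i prev t

toℕ-shift-zero : ∀ {m} t → t < suc m → toℕ (shift {m} t zero) ≡ t
toℕ-shift-zero zero    _           = refl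
toℕ-shift-zero {m} (suc t) (s≤s t<m) =
  trans (toℕ-next (shift t zero) (subst (_< m) (sym ih) t<m)) (cong suc ih)
  where ih = toℕ-shift-zero t (ℕ.m<n⇒m<1+n t<m)

shift-zero : ∀ {m} (k : Fin (suc m)) → shift (toℕ k) zero ≡ k
shift-zero k = toℕ-injective (toℕ-shift-zero (toℕ k) (toℕ<n k))

unshift-shift : ∀ {m} t (i : Fin (suc m)) → unshift t (shift t i) ≡ i
unshift-shift t i = fold-inverse next prev prev-next i t

shift-unshift : ∀ {m} t (i : Fin (suc m)) → shift t (unshift t i) ≡ i
shift-unshift t i = fold-inverse prev next next-prev i t

shift-injective : ∀ {m} t {i j : Fin (suc m)} → shift t i ≡ shift t j → i ≡ j
shift-injective t {i} {j} e = trans (sym (unshift-shift t i)) (trans (cong (unshift t) e) (unshift-shift t j))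

module _ {a ℓ₁ ℓ₂} {A : Set a} {_≈_ : Rel A ℓ₁} {_<_ : Rel A ℓ₂}
         (<-isStrictTotalOrder : IsStrictTotalOrder _≈_ _<_) where
  open IsStrictTotalOrder <-isStrictTotalOrder using (compare; irrefl; module Eq) renaming (trans to <-trans)

  argmin : ∀ {n} (f : Fin (suc n) → A) → ∃ λ c → ∀ j → ¬ (f j < f c)
  argmin {zero}  f = zero , λ { zero → irrefl Eq.refl }
  argmin {suc n} f with argmin (f ∘ suc)
  ... | c , minimal with compare (f zero) (f (suc c))
  ... | tri< f₀<f꜀ _ _ = zero , λ { zero    → irrefl Eq.refl
                                  ; (suc j) fⱼ<f₀ → minimal j (<-trans fⱼ<f₀ f₀<f꜀) }
  ... | tri≈ f₀≮f꜀ _ _ = suc c , λ { zero → f₀≮f꜀ ; (suc j) → minimal j }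
  ... | tri> f₀≮f꜀ _ _ = suc c , λ { zero → f₀≮f꜀ ; (suc j) → minimal j }

  ≉∧≯⇒< : ∀ {x y} → ¬ (x ≈ y) → ¬ (y < x) → x < y
  ≉∧≯⇒< {x} {y} x≉y y≮x with compare x y
  ... | tri< x<y _ _   = x<y
  ... | tri≈ _ x≈y _   = ⊥-elim (x≉y x≈y)
  ... | tri> _ _ y<x   = ⊥-elim (y≮x y<x)

reindex : ∀ {m n} → (Fin n → Fin m) → Vec A m → Vec A n
reindex τ v = tabulate (lookup v ∘ τ)

lookup-reindex : ∀ {m n} (τ : Fin n → Fin m) (v : Vec A m) i → lookup (reindex τ v) i ≡ lookup v (τ i)
lookup-reindex τ v = Vec.lookup∘tabulate (lookup v ∘ τ)

reindex-inverse : ∀ {n} (τ τ′ : Fin n → Fin n) → (∀ i → τ′ (τ i) ≡ i) →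
                  (v : Vec A n) → reindex τ (reindex τ′ v) ≡ v
reindex-inverse τ τ′ τ′τ≡id v = trans
  (Vec.tabulate-cong (λ i → trans (lookup-reindex τ′ v (τ i)) (cong (lookup v) (τ′τ≡id i))))
  (Vec.tabulate∘lookup v)

rotate : ∀ {m} → Fin (suc m) → Vec A (suc m) → Vec A (suc m)
rotate k = reindex (shift (toℕ k))

unrotate : ∀ {m} → Fin (suc m) → Vec A (suc m) → Vec A (suc m)
unrotate k = reindex (unshift (toℕ k))

rotate-unrotate : ∀ {m} (k : Fin (suc m)) (v : Vec A (suc m)) → rotate k (unrotate k v) ≡ v
rotate-unrotate k = reindex-inverse (shift (toℕ k)) (unshift (toℕ k)) (unshift-shift (toℕ k))

unrotate-rotate : ∀ {m} (k : Fin (suc m)) (v : Vec A (suc m)) → unrotate k (rotate k v) ≡ v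
unrotate-rotate k = reindex-inverse (unshift (toℕ k)) (shift (toℕ k)) (shift-unshift (toℕ k))

module _ {q : ℕ} (F : FiniteField q) where
  open FiniteField F using (0#; 1#; inv; inv-r; 0≢1; isCommutativeRing; -_) renaming (_*_ to _·_)
  open JGraph F

  private
    commutativeRing : CommutativeRing 0ℓ 0ℓ
    commutativeRing = record { isCommutativeRing = isCommutativeRing }

  open CommutativeRing commutativeRing using (*-comm; *-assoc; *-identityˡ; *-identityʳ; zeroʳ; distribˡ)
  open CommutativeSemigroupProperties (CommutativeRing.*-commutativeSemigroup commutativeRing)
    using () renaming (interchange to ·-interchange)
  open RingProperties (CommutativeRing.ring commutativeRing) using (-‿distribʳ-*)

  inv-l : ∀ x → x ≢ 0# → inv x · x ≡ 1#
  inv-l x x≢0 = trans (*-comm (inv x) x) (inv-r x x≢0)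

  inv-·-cancelˡ : ∀ {x} → x ≢ 0# → ∀ y → inv x · (x · y) ≡ y
  inv-·-cancelˡ {x} x≢0 y = trans (sym (*-assoc (inv x) x y)) (trans (cong (_· y) (inv-l x x≢0)) (*-identityˡ y))

  ·-inv-cancelˡ : ∀ {x} → x ≢ 0# → ∀ y → x · (inv x · y) ≡ y
  ·-inv-cancelˡ {x} x≢0 y = trans (sym (*-assoc x (inv x) y)) (trans (cong (_· y) (inv-r x x≢0)) (*-identityˡ y))

  ·-cancelˡ : ∀ l {x y} → l ≢ 0# → l · x ≡ l · y → x ≡ y
  ·-cancelˡ l {x} {y} l≢0 lx≡ly =
    trans (sym (inv-·-cancelˡ l≢0 x)) (trans (cong (inv l ·_) lx≡ly) (inv-·-cancelˡ l≢0 y))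

  ·-nonzero : ∀ {x y} → x ≢ 0# → y ≢ 0# → x · y ≢ 0#
  ·-nonzero {x} x≢0 y≢0 xy≡0 = y≢0 (·-cancelˡ x x≢0 (trans xy≡0 (sym (zeroʳ x))))

  inv-nonzero : ∀ {x} → x ≢ 0# → inv x ≢ 0#
  inv-nonzero {x} x≢0 inv≡0 = 0≢1 (trans (sym (zeroʳ x)) (trans (cong (x ·_) (sym inv≡0)) (inv-r x x≢0)))

  scale : Fin q → Pt → Pt
  scale l (a , b) = l · a , l · b

  scale-inverse : ∀ {l} → l ≢ 0# → ∀ p → scale (inv l) (scale l p) ≡ p
  scale-inverse l≢0 (a , b) = cong₂ _,_ (inv-·-cancelˡ l≢0 a) (inv-·-cancelˡ l≢0 b)

  scale-inverseʳ : ∀ {l} → l ≢ 0# → ∀ p → scale l (scale (inv l) p) ≡ p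
  scale-inverseʳ l≢0 (a , b) = cong₂ _,_ (·-inv-cancelˡ l≢0 a) (·-inv-cancelˡ l≢0 b)

  scale-injective : ∀ {l} → l ≢ 0# → ∀ {p p′} → scale l p ≡ scale l p′ → p ≡ p′
  scale-injective l≢0 {p} {p′} e =
    trans (sym (scale-inverse l≢0 p)) (trans (cong (scale _) e) (scale-inverse l≢0 p′))

  scale-isVertex : ∀ {l} → l ≢ 0# → ∀ {p} → IsVertex p → IsVertex (scale l p)
  scale-isVertex {l} l≢0 {a , b} (a≢0 , b≢0 , (ab≢0 , y , y²≡ab) , a≢b , a≢-b) =
    ·-nonzero l≢0 a≢0 ,
    ·-nonzero l≢0 b≢0 ,
    (·-nonzero (·-nonzero l≢0 a≢0) (·-nonzero l≢0 b≢0) ,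
     l · y , trans (·-interchange l y l y) (trans (cong (l · l ·_) y²≡ab) (·-interchange l l a b))) ,
    a≢b ∘ ·-cancelˡ l l≢0 ,
    λ la≡-lb → a≢-b (·-cancelˡ l l≢0 (trans la≡-lb (-‿distribʳ-* l b)))

  scale-edge : ∀ l {p r} → Edge p r → Edge (scale l p) (scale l r)
  scale-edge l {a , b} {c , d} (c≡mean , d²≡ab) =
    trans (cong (l ·_) c≡mean) (trans (sym (*-assoc l _ _)) (cong (_· _) (distribˡ l a b))) ,
    trans (·-interchange l d l d) (trans (cong (l · l ·_) d²≡ab) (·-interchange l l a b))

  record RootedCycle (m : ℕ) (v : Vec Pt (suc m)) : Set where
    constructor rootedCycle
    field
      vertices : ∀ i → IsVertex (lookup v i)
      distinct : ∀ i j → i ≢ j → lookup v i ≢ lookup v j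
      edges    : ∀ i → Edge (lookup v i) (lookup v (next i))

  rootedCycle? : ∀ m v → Dec (RootedCycle m v)
  rootedCycle? m v = map′ (λ (vs , ds , es) → rootedCycle vs ds es) (λ (rootedCycle vs ds es) → vs , ds , es)
    (all? (λ i → isVertex? (lookup v i))
     ×-dec all? (λ i → all? (λ j → ¬? (i Fin.≟ j) →-dec ¬? (lookup v i ≟P lookup v j)))
     ×-dec all? (λ i → edge? (lookup v i) (lookup v (next i))))

  StartsAtMinimum : (m : ℕ) → Vec Pt (suc m) → Set
  StartsAtMinimum m v = ∀ i → i ≢ zero → LexLess (lookup v zero) (lookup v i)

  isCycleRep⇒rootedCycle : ∀ {m v} → IsCycleRep m v → RootedCycle m v × StartsAtMinimum m v
  isCycleRep⇒rootedCycle {m} {v} (vertices , distinct , steps , closing , minimal) =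
    rootedCycle vertices distinct edges , minimal
    where
    edges : ∀ j → Edge (lookup v j) (lookup v (next j))
    edges j with lastOrInject₁ j
    ... | last       = subst (Edge (lookup v j) ∘ lookup v) (sym (next-fromℕ m)) closing
    ... | inject₁′ i = subst (Edge (lookup v j) ∘ lookup v) (sym (next-inject₁ i)) (steps i)

  rootedCycle⇒isCycleRep : ∀ {m v} → RootedCycle m v → StartsAtMinimum m v → IsCycleRep m v
  rootedCycle⇒isCycleRep {m} {v} (rootedCycle vertices distinct edges) minimal =
    vertices , distinct ,
    (λ i → subst (Edge (lookup v (inject₁ i)) ∘ lookup v) (next-inject₁ i) (edges (inject₁ i))) ,
    subst (Edge (lookup v (fromℕ m)) ∘ lookup v) (next-fromℕ m) (edges (fromℕ m)) ,
    minimal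

  reindex-rootedCycle : ∀ {m v} (τ τ′ : Fin (suc m) → Fin (suc m)) → (∀ i → τ′ (τ i) ≡ i) →
                        (∀ i → τ (next i) ≡ next (τ i)) → RootedCycle m v → RootedCycle m (reindex τ v)
  reindex-rootedCycle {v = v} τ τ′ τ′τ≡id τ-next (rootedCycle vertices distinct edges) = rootedCycle
    (λ i → subst IsVertex (sym (lookupᵀ i)) (vertices (τ i)))
    (λ i j i≢j vᵢ≡vⱼ → distinct (τ i) (τ j) (λ τi≡τj → i≢j (τ-injective τi≡τj))
                        (trans (sym (lookupᵀ i)) (trans vᵢ≡vⱼ (lookupᵀ j))))
    (λ i → subst₂ Edge (sym (lookupᵀ i)) (trans (cong (lookup v) (sym (τ-next i))) (sym (lookupᵀ (next i))))
                  (edges (τ i)))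
    where
    lookupᵀ = lookup-reindex τ v
    τ-injective : ∀ {i j} → τ i ≡ τ j → i ≡ j
    τ-injective {i} {j} e = trans (sym (τ′τ≡id i)) (trans (cong τ′ e) (τ′τ≡id j))

  rotate-rootedCycle : ∀ {m v} (k : Fin (suc m)) → RootedCycle m v → RootedCycle m (rotate k v)
  rotate-rootedCycle k = reindex-rootedCycle (shift (toℕ k)) (unshift (toℕ k))
    (unshift-shift (toℕ k))
    (λ i → fold-commute next next (λ _ → refl) i (toℕ k))

  rotate-rootedCycle⁻¹ : ∀ {m v} (k : Fin (suc m)) → RootedCycle m (rotate k v) → RootedCycle m v
  rotate-rootedCycle⁻¹ {m} {v} k rc = subst (RootedCycle m) (unrotate-rotate k v)
    (reindex-rootedCycle (unshift (toℕ k)) (shift (toℕ k))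
      (shift-unshift (toℕ k))
      (λ i → fold-commute next prev (λ j → trans (next-prev j) (sym (prev-next j))) i (toℕ k))
      rc)

  enumerates-allFinL : ∀ n → Enumerates Fin._≟_ (allFinL n)
  enumerates-allFinL (suc n) .once zero    = cong suc (trans (∑-map suc (allFinL n) _) (∑-zero (allFinL n)))
  enumerates-allFinL (suc n) .once (suc x) = trans (∑-map suc (allFinL n) _) (trans
    (∑-cong (allFinL n) (λ y → 𝟙-cong (suc x Fin.≟ suc y) (x Fin.≟ y) suc-injective (cong suc)))
    (enumerates-allFinL n .once x))

  length-allFinL : ∀ n → length (allFinL n) ≡ n
  length-allFinL zero    = refl
  length-allFinL (suc n) = cong suc (trans (length-map suc (allFinL n)) (length-allFinL n))

  enumerates-allPts : Enumerates _≟P_ allPts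
  enumerates-allPts = enumerates-pairs Fin._≟_ Fin._≟_ _≟P_ _,_ (λ { refl → refl , refl }) (λ (a , b) → a , b , refl)
    (enumerates-allFinL q) (enumerates-allFinL q)

  _≟V_ : ∀ {n} → DecidableEquality (Vec Pt n)
  _≟V_ = Vec.≡-dec _≟P_

  enumerates-allVecs : ∀ n → Enumerates _≟V_ (allVecs n)
  enumerates-allVecs zero .once [] = refl
  enumerates-allVecs (suc n) = enumerates-pairs _≟P_ _≟V_ _≟V_ _∷_ (λ { refl → refl , refl })
    (λ { (p ∷ w) → p , w , refl }) enumerates-allPts (enumerates-allVecs n)

  -- LexLess is by definition the lexicographic product ×-Lex _≡_ Fin._<_ Fin._<_.
  LexLess-isStrictTotalOrder : IsStrictTotalOrder (Pointwise _≡_ _≡_) LexLess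
  LexLess-isStrictTotalOrder = ×-isStrictTotalOrder Fin.<-isStrictTotalOrder Fin.<-isStrictTotalOrder

  module _ {m : ℕ} {v : Vec Pt (suc m)} where

    lookup-rotate : ∀ k i → lookup (rotate k v) i ≡ lookup v (shift (toℕ k) i)
    lookup-rotate k = lookup-reindex (shift (toℕ k)) v

    lookup-rotate-zero : ∀ k → lookup (rotate k v) zero ≡ lookup v k
    lookup-rotate-zero k = trans (lookup-rotate k zero) (cong (lookup v) (shift-zero k))

    -- The representative is the rotation starting at the least vertex, which exists and is
    -- strictly least because the vertices of a rooted cycle are distinct.
    unique-rotation-isCycleRep : RootedCycle m v →
      ∃ λ c → IsCycleRep m (rotate c v) × (∀ k → IsCycleRep m (rotate k v) → k ≡ c)
    unique-rotation-isCycleRep rc = c , rep-c , only-c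
      where
      minimum = argmin LexLess-isStrictTotalOrder (lookup v)
      c = proj₁ minimum
      minimal = proj₂ minimum

      rep-c : IsCycleRep m (rotate c v)
      rep-c = rootedCycle⇒isCycleRep (rotate-rootedCycle c rc) starts
        where
        starts : StartsAtMinimum m (rotate c v)
        starts i i≢0 = subst₂ LexLess (sym (lookup-rotate-zero c)) (sym (lookup-rotate c i))
          (≉∧≯⇒< LexLess-isStrictTotalOrder (RootedCycle.distinct rc c j c≢j ∘ ≡×≡⇒≡) (minimal j))
          where
          j = shift (toℕ c) i
          c≢j : c ≢ j
          c≢j c≡j = i≢0 (shift-injective (toℕ c) (trans (sym c≡j) (sym (shift-zero c))))

      only-c : ∀ k → IsCycleRep m (rotate k v) → k ≡ c
      only-c k rep with k Fin.≟ c
      ... | yes k≡c = k≡c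
      ... | no  k≢c = ⊥-elim (minimal k vₖ<v꜀)
        where
        i = unshift (toℕ k) c
        i≢0 : i ≢ zero
        i≢0 i≡0 = k≢c (begin
          k                    ≡⟨ shift-zero k ⟨
          shift (toℕ k) zero  ≡⟨ cong (shift (toℕ k)) i≡0 ⟨
          shift (toℕ k) i     ≡⟨ shift-unshift (toℕ k) c ⟩
          c                    ∎)
          where open ≡-Reasoning
        vₖ<v꜀ : LexLess (lookup v k) (lookup v c)
        vₖ<v꜀ = subst₂ LexLess (lookup-rotate-zero k)
                  (trans (lookup-rotate k i) (cong (lookup v) (shift-unshift (toℕ k) c)))
                  (proj₂ (isCycleRep⇒rootedCycle {v = rotate k v} rep) i i≢0)

  𝟙-rootedCycle≡∑-rotations : ∀ m v →
    𝟙 (rootedCycle? m v) ≡ ∑[ k ∈ allFinL (suc m) ] 𝟙 (isCycleRep? m (rotate k v))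
  𝟙-rootedCycle≡∑-rotations m v with rootedCycle? m v
  ... | yes rc with unique-rotation-isCycleRep rc
  ...   | c , rep-c , only-c = sym (trans
    (∑-cong (allFinL (suc m)) (λ k → 𝟙-cong (isCycleRep? m (rotate k v)) (c Fin.≟ k)
      (sym ∘ only-c k) (λ { refl → rep-c })))
    (enumerates-allFinL (suc m) .once c))
  𝟙-rootedCycle≡∑-rotations m v | no ¬rc = sym (trans
    (∑-cong (allFinL (suc m)) (λ k → 𝟙-no (isCycleRep? m (rotate k v))
      (¬rc ∘ rotate-rootedCycle⁻¹ k ∘ proj₁ ∘ isCycleRep⇒rootedCycle {v = rotate k v})))
    (∑-zero (allFinL (suc m))))

  ∑-rootedCycles-by-rotation : ∀ m →
    ∑[ v ∈ allVecs (suc m) ] 𝟙 (rootedCycle? m v) ≡ suc m * cycleCount (suc m)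
  ∑-rootedCycles-by-rotation m = begin
    ∑[ v ∈ vecs ] 𝟙 (rootedCycle? m v)                       ≡⟨ ∑-cong vecs (𝟙-rootedCycle≡∑-rotations m) ⟩
    ∑[ v ∈ vecs ] ∑[ k ∈ ks ] 𝟙 (isCycleRep? m (rotate k v)) ≡⟨ ∑-swap vecs ks _ ⟩
    ∑[ k ∈ ks ] ∑[ v ∈ vecs ] 𝟙 (isCycleRep? m (rotate k v)) ≡⟨ ∑-cong ks (sym ∘ rotate-invariant) ⟩
    ∑[ k ∈ ks ] ∑[ v ∈ vecs ] 𝟙 (isCycleRep? m v)            ≡⟨ ∑-const ks _ ⟩
    length ks * ∑[ v ∈ vecs ] 𝟙 (isCycleRep? m v)            ≡⟨ cong₂ _*_ (length-allFinL (suc m))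
                                                                  (sym (length-filter≡∑𝟙 (isCycleRep? m) vecs)) ⟩
    suc m * cycleCount (suc m)                                ∎
    where
    open ≡-Reasoning
    vecs = allVecs (suc m)
    ks = allFinL (suc m)
    rotate-invariant : ∀ k → ∑[ v ∈ vecs ] 𝟙 (isCycleRep? m v) ≡ ∑[ v ∈ vecs ] 𝟙 (isCycleRep? m (rotate k v))
    rotate-invariant k = ∑-reindex _≟V_ (enumerates-allVecs (suc m))
      (rotate k) (unrotate k) (unrotate-rotate k) (rotate-unrotate k) (λ v → 𝟙 (isCycleRep? m v))

  scale-rootedCycle : ∀ {l} → l ≢ 0# → ∀ {m v} → RootedCycle m v → RootedCycle m (Vec.map (scale l) v)
  scale-rootedCycle {l} l≢0 {v = v} (rootedCycle vertices distinct edges) = rootedCycle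
    (λ i → subst IsVertex (sym (lookupˢ i)) (scale-isVertex l≢0 (vertices i)))
    (λ i j i≢j e → distinct i j i≢j (scale-injective l≢0 (trans (sym (lookupˢ i)) (trans e (lookupˢ j)))))
    (λ i → subst₂ Edge (sym (lookupˢ i)) (sym (lookupˢ (next i))) (scale-edge l (edges i)))
    where
    lookupˢ : ∀ i → lookup (Vec.map (scale l) v) i ≡ scale l (lookup v i)
    lookupˢ i = Vec.lookup-map i (scale l) v

  map-scale-inverse : ∀ {l} → l ≢ 0# → ∀ {n} (v : Vec Pt n) → Vec.map (scale (inv l)) (Vec.map (scale l) v) ≡ v
  map-scale-inverse l≢0 v = trans (sym (Vec.map-∘ _ _ v)) (trans (Vec.map-cong (scale-inverse l≢0) v) (Vec.map-id v))

  map-scale-inverseʳ : ∀ {l} → l ≢ 0# → ∀ {n} (v : Vec Pt n) → Vec.map (scale l) (Vec.map (scale (inv l)) v) ≡ v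
  map-scale-inverseʳ l≢0 v = trans (sym (Vec.map-∘ _ _ v)) (trans (Vec.map-cong (scale-inverseʳ l≢0) v) (Vec.map-id v))

  scale-rootedCycle⁻¹ : ∀ {l} → l ≢ 0# → ∀ {m v} → RootedCycle m (Vec.map (scale l) v) → RootedCycle m v
  scale-rootedCycle⁻¹ l≢0 {m} {v} rc =
    subst (RootedCycle m) (map-scale-inverse l≢0 v) (scale-rootedCycle (inv-nonzero l≢0) rc)

  rootedCyclesAt : ℕ → Pt → ℕ
  rootedCyclesAt m p = ∑[ w ∈ allVecs m ] 𝟙 (rootedCycle? m (p ∷ w))

  rootedCyclesAt-scale : ∀ m {l} → l ≢ 0# → ∀ p → rootedCyclesAt m (scale l p) ≡ rootedCyclesAt m p
  rootedCyclesAt-scale m {l} l≢0 p = trans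
    (∑-reindex _≟V_ (enumerates-allVecs m) (Vec.map (scale l)) (Vec.map (scale (inv l)))
      (map-scale-inverse l≢0) (map-scale-inverseʳ l≢0) (λ w → 𝟙 (rootedCycle? m (scale l p ∷ w))))
    (∑-cong (allVecs m) (λ w → 𝟙-cong (rootedCycle? m (scale l p ∷ Vec.map (scale l) w)) (rootedCycle? m (p ∷ w))
      (scale-rootedCycle⁻¹ l≢0) (scale-rootedCycle l≢0)))

  rootedCyclesAt-zero : ∀ m b → rootedCyclesAt m (0# , b) ≡ 0
  rootedCyclesAt-zero m b = trans
    (∑-cong (allVecs m) (λ w → 𝟙-no (rootedCycle? m ((0# , b) ∷ w)) (λ rc → proj₁ (RootedCycle.vertices rc zero) refl)))
    (∑-zero (allVecs m))

  rootedCyclesAtOne : ℕ → ℕ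
  rootedCyclesAtOne m = ∑[ b ∈ allFinL q ] rootedCyclesAt m (1# , b)

  ∑-rootedCyclesAt-row : ∀ m {a} → a ≢ 0# → ∑[ b ∈ allFinL q ] rootedCyclesAt m (a , b) ≡ rootedCyclesAtOne m
  ∑-rootedCyclesAt-row m {a} a≢0 = begin
    ∑[ b ∈ allFinL q ] rootedCyclesAt m (a , b)            ≡⟨ ∑-reindex Fin._≟_ (enumerates-allFinL q)
                                                                (a ·_) (inv a ·_) (inv-·-cancelˡ a≢0) (·-inv-cancelˡ a≢0) _ ⟩
    ∑[ b ∈ allFinL q ] rootedCyclesAt m (a , a · b)        ≡⟨ ∑-cong (allFinL q) (λ b →
                                                                cong (λ x → rootedCyclesAt m (x , a · b)) (sym (*-identityʳ a))) ⟩
    ∑[ b ∈ allFinL q ] rootedCyclesAt m (scale a (1# , b)) ≡⟨ ∑-cong (allFinL q) (rootedCyclesAt-scale m a≢0 ∘ (1# ,_)) ⟩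
    rootedCyclesAtOne m                                    ∎
    where open ≡-Reasoning

  ∑-rootedCyclesAt-row-𝟙 : ∀ m a →
    ∑[ b ∈ allFinL q ] rootedCyclesAt m (a , b) ≡ 𝟙 (¬? (a Fin.≟ 0#)) * rootedCyclesAtOne m
  ∑-rootedCyclesAt-row-𝟙 m a = row (a Fin.≟ 0#)
    where
    row : (a≟0 : Dec (a ≡ 0#)) → ∑[ b ∈ allFinL q ] rootedCyclesAt m (a , b) ≡ 𝟙 (¬? a≟0) * rootedCyclesAtOne m
    row (yes refl) = trans (∑-cong (allFinL q) (rootedCyclesAt-zero m)) (∑-zero (allFinL q))
    row (no a≢0)   = trans (∑-rootedCyclesAt-row m a≢0) (sym (ℕ.+-identityʳ _))

  ∑-rootedCycles-by-scaling : ∀ m →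
    ∑[ v ∈ allVecs (suc m) ] 𝟙 (rootedCycle? m v) ≡ (q ∸ 1) * rootedCyclesAtOne m
  ∑-rootedCycles-by-scaling m = begin
    ∑[ v ∈ allVecs (suc m) ] 𝟙 (rootedCycle? m v)                 ≡⟨ ∑-pairs _∷_ allPts (allVecs m) _ ⟩
    ∑[ p ∈ allPts ] rootedCyclesAt m p                            ≡⟨ ∑-pairs _,_ (allFinL q) (allFinL q) _ ⟩
    ∑[ a ∈ allFinL q ] ∑[ b ∈ allFinL q ] rootedCyclesAt m (a , b) ≡⟨ ∑-cong (allFinL q) (∑-rootedCyclesAt-row-𝟙 m) ⟩
    ∑[ a ∈ allFinL q ] (𝟙 (¬? (a Fin.≟ 0#)) * K)                 ≡⟨ ∑-*ʳ (allFinL q) _ K ⟩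
    (∑[ a ∈ allFinL q ] 𝟙 (¬? (a Fin.≟ 0#))) * K                 ≡⟨ cong (_* K) (∑-𝟙-≢ Fin._≟_ (enumerates-allFinL q) 0#) ⟩
    (length (allFinL q) ∸ 1) * K                                  ≡⟨ cong (λ n → (n ∸ 1) * K) (length-allFinL q) ⟩
    (q ∸ 1) * K                                                   ∎
    where
    open ≡-Reasoning
    K = rootedCyclesAtOne m

theorem3p7 : (q : ℕ) → (F : FiniteField q) → q % 2 ≡ 1 →
    (n : ℕ) → 1 ≤ n → (q ∸ 1) ∣ n * JGraph.cycleCount F n
theorem3p7 q F _ (suc m) _ = divides (rootedCyclesAtOne F m) (begin
  suc m * JGraph.cycleCount F (suc m)                      ≡⟨ ∑-rootedCycles-by-rotation F m ⟨
  ∑[ v ∈ JGraph.allVecs F (suc m) ] 𝟙 (rootedCycle? F m v) ≡⟨ ∑-rootedCycles-by-scaling F m ⟩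
  (q ∸ 1) * rootedCyclesAtOne F m                          ≡⟨ ℕ.*-comm (q ∸ 1) _ ⟩
  rootedCyclesAtOne F m * (q ∸ 1)                          ∎)
  where open ≡-Reasoning
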